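{- Let $m,n$ be positive integers, let $L\in\mathcal{D}(B^m,B^n)$, let $f:B^m\to B^n$ be a function, and let $b\in B^m$. Then $L$ is a differential of $f$ at $b$ if and only if one of the following holds: (1) $L$ is isolated and $L(x)=f(x)$ for every $x\in N(b)$; (2) $L$ is not isolated but constant, $f(N(b))\subseteq N(0_n)$, and $f(0_m)=0_n$ if $0_m\in N(b)$; or (3) $L$ is not isolated and not constant, there exists a unique $\beta\in N(0_n)\setminus\{0_n\}$ such that $f(N(b))\subseteq L(B^m)=\{0_n,\beta\}$, and $f(0_m)=0_n$ if $0_m\in N(b)$.
   Context: The $n$-Boolean hypercube $B^n$ is the set $\{0,1\}^n=\bigoplus_{i=1}^n\mathbb{Z}_2$ regarded as the Cayley graph with generators the standard basis vectors: its graph neighborhoods are $N(a)=\{c\in\{0,1\}^n: c \text{ differs from } a \text{ in at most one coordinate}\}$, and a filter $\mathcal{F}$ converges to $a$ iff $N(a)\in\mathcal{F}$. $0_n$ denotes the zero vector. For reflexive digraphs, continuous maps are maps $g$ with $g(N(v))\subseteq N(g(v))$, and the space of continuous maps is a reflexive digraph with $g\in N(h)$ iff $g(x)\in N(h(y))$ whenever $x\in N(y)$. $\mathcal{D}(B^m,B^n)$ is the set of $\mathbb{Z}_2$-linear maps $B^m\to B^n$ that are continuous, with neighborhoods induced from the function-space digraph. $L$ is isolated if $N(L)\cap\mathcal{D}(B^m,B^n)=\{L\}$; constant means $L\equiv 0_n$. Differential: $L$ is a differential of $f$ at $b$ iff for every filter $\mathcal{A}\to b$ there is a filter $\mathcal{L}$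 on $\mathcal{D}(B^m,B^n)$ converging to $L$ (i.e. containing $N(L)\cap\mathcal{D}(B^m,B^n)$) such that for every $K\in\mathcal{L}$ there is $A\in\mathcal{A}$ with $f(x)\in\{k(x):k\in K\}$ for every $x\in A$. -}

module Defs where

open import Level using (0ℓ)
open import Data.Nat using (ℕ)
open import Data.Bool using (Bool; true; false; not; _xor_)
open import Data.Fin using (Fin)
open import Data.Vec using (Vec; replicate; zipWith; _[_]%=_)
open import Data.Product using (Σ; Σ-syntax; ∃; ∃-syntax; _×_; _,_)
open import Data.Sum using (_⊎_)
open import Data.Unit using (⊤)
open import Data.Empty using (⊥)
open import Relation.Nullary using (¬_)
open import Relation.Unary using (Pred; _⊆_; _∩_)
open import Relation.Binary.PropositionalEquality using (_≡_)

B : ℕ → Set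
B n = Vec Bool n

𝟘 : (n : ℕ) → B n
𝟘 n = replicate n false

_⊕_ : ∀ {n} → B n → B n → B n
_⊕_ = zipWith _xor_

N : ∀ {n} → B n → Pred (B n) 0ℓ
N {n} a c = (c ≡ a) ⊎ Σ (Fin n) (λ i → c ≡ a [ i ]%= not)

Continuous : ∀ {m n} → (B m → B n) → Set
Continuous g = ∀ v c → N v c → N (g v) (g c)

IsLinear : ∀ {m n} → (B m → B n) → Set
IsLinear g = ∀ x y → g (x ⊕ y) ≡ g x ⊕ g y

record D (m n : ℕ) : Set where
  constructor mkD
  field
    fun        : B m → B n
    linear     : IsLinear fun
    continuous : Continuous fun
open D public

NF : ∀ {m n} → (B m → B n) → Pred (B m → B n) 0ℓ
NF h g = ∀ x y → N y x → N (h y) (g x)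

ND : ∀ {m n} → D m n → Pred (D m n) 0ℓ
ND L K = NF (fun L) (fun K)

record Filter (X : Set) : Set₁ where
  field
    member  : Pred (Pred X 0ℓ) 0ℓ
    univ    : member (λ _ → ⊤)
    proper  : ¬ member (λ _ → ⊥)
    upward  : ∀ {P Q : Pred X 0ℓ} → P ⊆ Q → member P → member Q
    meet    : ∀ {P Q : Pred X 0ℓ} → member P → member Q → member (P ∩ Q)
open Filter public

ConvB : ∀ {m} → Filter (B m) → B m → Set
ConvB 𝒜 a = member 𝒜 (N a)

ConvD : ∀ {m n} → Filter (D m n) → D m n → Set
ConvD ℒ L = member ℒ (ND L)

IsDifferential : ∀ {m n} → D m n → (B m → B n) → B m → Set₁
IsDifferential {m} {n} L f b =
  (𝒜 : Filter (B m)) → ConvB 𝒜 b →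
  Σ (Filter (D m n)) λ ℒ → ConvD ℒ L ×
    (∀ (K : Pred (D m n) 0ℓ) → member ℒ K →
      Σ (Pred (B m) 0ℓ) λ A → member 𝒜 A ×
        (∀ x → A x → ∃[ k ] (K k × f x ≡ fun k x)))

-- L is isolated: N(L) ∩ 𝒟 = {L} (elements of 𝒟 compared extensionally)
Isolated : ∀ {m n} → D m n → Set
Isolated {m} {n} L = ND L L × (∀ (K : D m n) → ND L K → ∀ x → fun K x ≡ fun L x)

Constant : ∀ {m n} → D m n → Set
Constant {m} {n} L = ∀ x → fun L x ≡ 𝟘 n

-- L is a differential of f at b exactly when every value f(x), x ∈ N(b), is k(x) for some
-- k ∈ N(L) ∩ 𝒟.  This neighbourhood is understood via c ∈ N(a) ⇔ a ⊕ c ∈ N(0): if K ∈ N(L)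
-- differs from L somewhere, then L ⊕ K is a linear map into N(0) whose nonzero value γ is a
-- unit vector, and both L and K take values in {0, γ}.  Conversely every linear map with values
-- in {0, γ}, γ a unit vector, is near every other such map.  So L is isolated iff its image lies
-- in no {0, γ}; otherwise the maps near L are exactly those with image in {0, γ} (any γ when
-- L = 0), and these realise at x every value in {0, γ}, except that all of them vanish at x = 0.
module Submission where

open import Defs
open import Level using (0ℓ)
open import Data.Nat using (ℕ; _≤_; zero; suc)
open import Data.Bool using (Bool; true; false; not; _xor_; if_then_else_)
open import Data.Bool.Properties using (xor-comm; xor-assoc; xor-same; xor-identityʳ)
  renaming (_≟_ to _≟ᵇ_)
open import Data.Fin using (Fin; zero; suc)
open import Data.Fin.Properties using (any?)
open import Data.Vec using ([]; _∷_; lookup; tail; _[_]%=_)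
open import Data.Vec.Properties using (lookup-zipWith; ≡-dec)
open import Data.Vec.Relation.Binary.Pointwise.Inductive using (Pointwise-≡⇒≡; zipWith-comm; zipWith-assoc; zipWith-identityˡ; zipWith-identityʳ)
open import Data.Product using (_×_; ∃; ∃!; ∃-syntax; _,_; proj₁; proj₂)
open import Data.Sum using (_⊎_; inj₁; inj₂)
open import Data.Unit using (tt)
open import Data.Empty using (⊥-elim)
open import Relation.Nullary using (¬_; Dec; yes; no)
open import Relation.Unary using (Pred; _⊆_)
open import Relation.Binary.PropositionalEquality using (_≡_; _≢_; refl; sym; trans; cong; cong₂; subst; subst₂; module ≡-Reasoning)
open import Function.Bundles using (_⇔_; mk⇔; Equivalence)
open import Function.Construct.Composition using (_⇔-∘_)

private
  variable
    m n : ℕ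

⊕-comm : (a c : B n) → a ⊕ c ≡ c ⊕ a
⊕-comm a c = Pointwise-≡⇒≡ (zipWith-comm xor-comm a c)

⊕-assoc : (a b c : B n) → (a ⊕ b) ⊕ c ≡ a ⊕ (b ⊕ c)
⊕-assoc a b c = Pointwise-≡⇒≡ (zipWith-assoc xor-assoc a b c)

⊕-identityˡ : (a : B n) → 𝟘 n ⊕ a ≡ a
⊕-identityˡ a = Pointwise-≡⇒≡ (zipWith-identityˡ (λ _ → refl) a)

⊕-identityʳ : (a : B n) → a ⊕ 𝟘 n ≡ a
⊕-identityʳ a = Pointwise-≡⇒≡ (zipWith-identityʳ xor-identityʳ a)

⊕-self : (a : B n) → a ⊕ a ≡ 𝟘 n
⊕-self []      = refl
⊕-self (x ∷ a) = cong₂ _∷_ (xor-same x) (⊕-self a)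

⊕-cancelˡ : (a c : B n) → a ⊕ (a ⊕ c) ≡ c
⊕-cancelˡ a c = begin
  a ⊕ (a ⊕ c)  ≡⟨ ⊕-assoc a a c ⟨
  (a ⊕ a) ⊕ c  ≡⟨ cong (_⊕ c) (⊕-self a) ⟩
  𝟘 _ ⊕ c      ≡⟨ ⊕-identityˡ c ⟩
  c            ∎
  where open ≡-Reasoning

⊕≡𝟘⇒≡ : (a c : B n) → a ⊕ c ≡ 𝟘 n → a ≡ c
⊕≡𝟘⇒≡ a c p = begin
  a            ≡⟨ ⊕-identityʳ a ⟨
  a ⊕ 𝟘 _      ≡⟨ cong (a ⊕_) p ⟨
  a ⊕ (a ⊕ c)  ≡⟨ ⊕-cancelˡ a c ⟩
  c            ∎
  where open ≡-Reasoning

⊕-interchange : (a b c d : B n) → (a ⊕ b) ⊕ (c ⊕ d) ≡ (a ⊕ c) ⊕ (b ⊕ d)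
⊕-interchange a b c d = begin
  (a ⊕ b) ⊕ (c ⊕ d)  ≡⟨ ⊕-assoc a b (c ⊕ d) ⟩
  a ⊕ (b ⊕ (c ⊕ d))  ≡⟨ cong (a ⊕_) (⊕-assoc b c d) ⟨
  a ⊕ ((b ⊕ c) ⊕ d)  ≡⟨ cong (λ v → a ⊕ (v ⊕ d)) (⊕-comm b c) ⟩
  a ⊕ ((c ⊕ b) ⊕ d)  ≡⟨ cong (a ⊕_) (⊕-assoc c b d) ⟩
  a ⊕ (c ⊕ (b ⊕ d))  ≡⟨ ⊕-assoc a c (b ⊕ d) ⟨
  (a ⊕ c) ⊕ (b ⊕ d)  ∎
  where open ≡-Reasoning

infix 4 _≟ᴮ_
_≟ᴮ_ : (a c : B n) → Dec (a ≡ c)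
_≟ᴮ_ = ≡-dec _≟ᵇ_

e : Fin n → B n
e {n} i = 𝟘 n [ i ]%= not

e≢𝟘 : (i : Fin n) → e i ≢ 𝟘 n
e≢𝟘 zero    ()
e≢𝟘 (suc i) p = e≢𝟘 i (cong tail p)

flip≡⊕e : (a : B n) (i : Fin n) → a [ i ]%= not ≡ a ⊕ e i
flip≡⊕e (x ∷ a) zero    = cong₂ _∷_ (xor-comm true x) (sym (⊕-identityʳ a))
flip≡⊕e (x ∷ a) (suc i) = cong₂ _∷_ (sym (xor-identityʳ x)) (flip≡⊕e a i)

zero⊎lookup≡true : (x : B m) → x ≡ 𝟘 m ⊎ ∃ λ j → lookup x j ≡ true
zero⊎lookup≡true []          = inj₁ refl
zero⊎lookup≡true (true ∷ x)  = inj₂ (zero , refl)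
zero⊎lookup≡true (false ∷ x) with zero⊎lookup≡true x
... | inj₁ p       = inj₁ (cong (false ∷_) p)
... | inj₂ (j , q) = inj₂ (suc j , q)

flip-induction : (P : B m → Set) → P (𝟘 m) → (∀ y i → P y → P (y [ i ]%= not)) → ∀ y → P y
flip-induction {zero}  P p𝟘 step []      = p𝟘
flip-induction {suc m} P p𝟘 step (x ∷ y) = head x tail-case
  where
  tail-case : P (false ∷ y)
  tail-case = flip-induction (λ y → P (false ∷ y)) p𝟘 (λ y i → step (false ∷ y) (suc i)) y
  head : ∀ x → P (false ∷ y) → P (x ∷ y)
  head false p = p
  head true  p = step (false ∷ y) zero p

all⊎counterexample : (P : B m → Set) → (∀ y → Dec (P y)) → (∀ y → P y) ⊎ ∃ λ y → ¬ P y
all⊎counterexample {zero} P P? with P? []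
... | yes p  = inj₁ λ { [] → p }
... | no ¬p  = inj₂ ([] , ¬p)
all⊎counterexample {suc m} P P?
  with all⊎counterexample (λ y → P (false ∷ y)) (λ y → P? (false ∷ y))
     | all⊎counterexample (λ y → P (true ∷ y)) (λ y → P? (true ∷ y))
... | inj₂ (y , ¬p) | _             = inj₂ (false ∷ y , ¬p)
... | inj₁ _        | inj₂ (y , ¬p) = inj₂ (true ∷ y , ¬p)
... | inj₁ p₀       | inj₁ p₁       = inj₁ λ { (false ∷ y) → p₀ y ; (true ∷ y) → p₁ y }

Small : B n → Set
Small {n} = N (𝟘 n)

N⇒Small-⊕ : (a c : B n) → N a c → Small (a ⊕ c)
N⇒Small-⊕ a c (inj₁ refl)       = inj₁ (⊕-self a)
N⇒Small-⊕ a c (inj₂ (i , refl)) = inj₂ (i , trans (cong (a ⊕_) (flip≡⊕e a i)) (⊕-cancelˡ a (e i)))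

Small-⊕⇒N : (a c : B n) → Small (a ⊕ c) → N a c
Small-⊕⇒N a c (inj₁ p)       = inj₁ (sym (⊕≡𝟘⇒≡ a c p))
Small-⊕⇒N a c (inj₂ (i , p)) = inj₂ (i , (begin
  c            ≡⟨ ⊕-cancelˡ a c ⟨
  a ⊕ (a ⊕ c)  ≡⟨ cong (a ⊕_) p ⟩
  a ⊕ e i      ≡⟨ flip≡⊕e a i ⟨
  a [ i ]%= not ∎))
  where open ≡-Reasoning

Small? : (v : B n) → Dec (Small v)
Small? {n} v with v ≟ᴮ 𝟘 n | any? (λ i → v ≟ᴮ e i)
... | yes p | _     = yes (inj₁ p)
... | no _  | yes q = yes (inj₂ q)
... | no ¬p | no ¬q = no λ { (inj₁ p) → ¬p p ; (inj₂ q) → ¬q q }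

Small-tail : (v : B n) → Small (false ∷ v) → Small v
Small-tail v (inj₁ p)             = inj₁ (cong tail p)
Small-tail v (inj₂ (zero , ()))
Small-tail v (inj₂ (suc i , p))   = inj₂ (i , cong tail p)

¬Small-e₀⊕e-suc : (j : Fin n) → ¬ Small (e zero ⊕ e (suc j))
¬Small-e₀⊕e-suc j (inj₁ ())
¬Small-e₀⊕e-suc j (inj₂ (zero , p))    = e≢𝟘 j (trans (sym (⊕-identityˡ (e j))) (cong tail p))
¬Small-e₀⊕e-suc j (inj₂ (suc _ , ()))

Small-e⊕e⇒≡ : (i j : Fin n) → Small (e i ⊕ e j) → i ≡ j
Small-e⊕e⇒≡ zero    zero    _ = refl
Small-e⊕e⇒≡ zero    (suc j) s = ⊥-elim (¬Small-e₀⊕e-suc j s)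
Small-e⊕e⇒≡ (suc i) zero    s = ⊥-elim (¬Small-e₀⊕e-suc i (subst Small (⊕-comm (e (suc i)) (e zero)) s))
Small-e⊕e⇒≡ (suc i) (suc j) s = cong suc (Small-e⊕e⇒≡ i j (Small-tail _ s))

InSpan : B n → B n → Set
InSpan {n} β v = v ≡ 𝟘 n ⊎ v ≡ β

InSpan? : (β v : B n) → Dec (InSpan β v)
InSpan? {n} β v with v ≟ᴮ 𝟘 n | v ≟ᴮ β
... | yes p | _     = yes (inj₁ p)
... | no _  | yes q = yes (inj₂ q)
... | no ¬p | no ¬q = no λ { (inj₁ p) → ¬p p ; (inj₂ q) → ¬q q }

InSpan-⊕ : {β u v : B n} → InSpan β u → InSpan β v → InSpan β (u ⊕ v)
InSpan-⊕ (inj₁ refl) (inj₁ refl) = inj₁ (⊕-self _)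
InSpan-⊕ (inj₁ refl) (inj₂ refl) = inj₂ (⊕-identityˡ _)
InSpan-⊕ (inj₂ refl) (inj₁ refl) = inj₂ (⊕-identityʳ _)
InSpan-⊕ (inj₂ refl) (inj₂ refl) = inj₁ (⊕-self _)

InSpan-≢𝟘 : {β v : B n} → InSpan β v → v ≢ 𝟘 n → v ≡ β
InSpan-≢𝟘 (inj₁ p) v≢𝟘 = ⊥-elim (v≢𝟘 p)
InSpan-≢𝟘 (inj₂ p) _   = p

InSpan⇒Small : {β v : B n} → Small β → InSpan β v → Small v
InSpan⇒Small _  (inj₁ p)    = inj₁ p
InSpan⇒Small sβ (inj₂ refl) = sβ

InSpan⇒N : {β u v : B n} → Small β → InSpan β u → InSpan β v → N u v
InSpan⇒N sβ pu pv = Small-⊕⇒N _ _ (InSpan⇒Small sβ (InSpan-⊕ pu pv))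

-- Two distinct nonzero elements of N(0) are distinct unit vectors, whose sum is not in N(0).
Small-⊕⇒InSpan : (a c : B n) → Small a → Small c → Small (a ⊕ c) → a ≢ 𝟘 n → InSpan a c
Small-⊕⇒InSpan a c (inj₁ p)       _                _ a≢𝟘 = ⊥-elim (a≢𝟘 p)
Small-⊕⇒InSpan a c (inj₂ _)       (inj₁ q)         _ _   = inj₁ q
Small-⊕⇒InSpan a c (inj₂ (i , p)) (inj₂ (j , q)) s   _   =
  inj₂ (trans q (trans (cong e (sym (Small-e⊕e⇒≡ i j (subst Small (cong₂ _⊕_ p q) s)))) (sym p)))

ImageWithin : B n → (B m → B n) → Set
ImageWithin β g = ∀ y → InSpan β (g y)

ImageInUnitSpan : B n → (B m → B n) → Set
ImageInUnitSpan {n} β g = Small β × β ≢ 𝟘 n × ImageWithin β g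

linear-𝟘 : (K : D m n) → fun K (𝟘 m) ≡ 𝟘 n
linear-𝟘 {m} K = begin
  fun K (𝟘 m)                    ≡⟨ cong (fun K) (⊕-self (𝟘 m)) ⟨
  fun K (𝟘 m ⊕ 𝟘 m)              ≡⟨ linear K (𝟘 m) (𝟘 m) ⟩
  fun K (𝟘 m) ⊕ fun K (𝟘 m)      ≡⟨ ⊕-self _ ⟩
  𝟘 _                            ∎
  where open ≡-Reasoning

near-refl : (L : D m n) → ND L L
near-refl L x y y∼x = continuous L y x y∼x

ImageWithin⇒near : {β : B n} {g h : B m → B n} → Small β → ImageWithin β g → ImageWithin β h → NF g h
ImageWithin⇒near sβ img imh x y _ = InSpan⇒N sβ (img y) (imh x)

D-𝟘 : D m n
D-𝟘 {n = n} = mkD (λ _ → 𝟘 n) (λ _ _ → sym (⊕-self _)) (λ _ _ _ → inj₁ refl)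

scale : B n → Bool → B n
scale {n} β c = if c then β else 𝟘 n

scale-xor : (β : B n) (c d : Bool) → scale β (c xor d) ≡ scale β c ⊕ scale β d
scale-xor β true  true  = sym (⊕-self β)
scale-xor β true  false = sym (⊕-identityʳ β)
scale-xor β false true  = sym (⊕-identityˡ β)
scale-xor β false false = sym (⊕-self _)

scale-InSpan : (β : B n) (c : Bool) → InSpan β (scale β c)
scale-InSpan β true  = inj₂ refl
scale-InSpan β false = inj₁ refl

coordinate : Fin m → (β : B n) → Small β → D m n
coordinate j β sβ = mkD (λ y → scale β (lookup y j))
  (λ x y → trans (cong (scale β) (lookup-zipWith _xor_ j x y)) (scale-xor β _ _))
  (λ _ _ _ → InSpan⇒N sβ (scale-InSpan β _) (scale-InSpan β _))

-- L ⊕ K is linear with values in N(0); once it is nonzero at x, its value γ there is a unit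
-- vector, and the constraints K(eᵢ) ∈ N(0) and γ ⊕ K(eᵢ) ∈ N(0) pin every K(eᵢ) into {0, γ}.
near⇒ImageInUnitSpan : (L K : D m n) → ND L K → ∀ x → fun L x ⊕ fun K x ≢ 𝟘 n →
  ImageInUnitSpan (fun L x ⊕ fun K x) (fun L) × ImageWithin (fun L x ⊕ fun K x) (fun K)
near⇒ImageInUnitSpan {m} L K near x γ≢𝟘 = (M-small x , γ≢𝟘 , L-span) , K-span
  where
  M : B m → B _
  M y = fun L y ⊕ fun K y

  M-small : ∀ y → Small (M y)
  M-small y = N⇒Small-⊕ _ _ (near y y (inj₁ refl))

  M-linear : ∀ y z → M (y ⊕ z) ≡ M y ⊕ M z
  M-linear y z = trans (cong₂ _⊕_ (linear L y z) (linear K y z)) (⊕-interchange _ _ _ _)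

  M-span : ImageWithin (M x) M
  M-span y = Small-⊕⇒InSpan _ _ (M-small x) (M-small y) (subst Small (M-linear x y) (M-small (x ⊕ y))) γ≢𝟘

  K-flip : ∀ y i → fun K (y [ i ]%= not) ≡ fun K y ⊕ fun K (e i)
  K-flip y i = trans (cong (fun K) (flip≡⊕e y i)) (linear K y (e i))

  K-e-small : ∀ i → Small (fun K (e i))
  K-e-small i = subst (λ v → N v (fun K (e i))) (linear-𝟘 K) (continuous K (𝟘 m) (e i) (inj₂ (i , refl)))

  M⊕K-e-small : ∀ i → Small (M x ⊕ fun K (e i))
  M⊕K-e-small i = subst Small (trans (cong (fun L x ⊕_) (K-flip x i)) (sym (⊕-assoc _ _ _)))
    (N⇒Small-⊕ _ _ (near (x [ i ]%= not) x (inj₂ (i , refl))))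

  K-span : ImageWithin (M x) (fun K)
  K-span = flip-induction (λ y → InSpan (M x) (fun K y)) (inj₁ (linear-𝟘 K))
    λ y i Ky → subst (InSpan (M x)) (sym (K-flip y i))
      (InSpan-⊕ Ky (Small-⊕⇒InSpan _ _ (M-small x) (K-e-small i) (M⊕K-e-small i) γ≢𝟘))

  L-span : ImageWithin (M x) (fun L)
  L-span y = subst (InSpan (M x)) L≡M⊕K (InSpan-⊕ (M-span y) (K-span y))
    where
    L≡M⊕K : M y ⊕ fun K y ≡ fun L y
    L≡M⊕K = trans (⊕-assoc _ _ _) (trans (cong (fun L y ⊕_) (⊕-self _)) (⊕-identityʳ _))

ImageInUnitSpan⇒¬Isolated : {β : B n} (L : D (suc m) n) → ImageInUnitSpan β (fun L) → ¬ Isolated L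
ImageInUnitSpan⇒¬Isolated {β = β} L (sβ , β≢𝟘 , im) (_ , isolated) =
  β≢𝟘 (trans (isolated (coordinate zero β sβ) near-coordinate (e zero))
             (sym (isolated D-𝟘 near-𝟘 (e zero))))
  where
  near-coordinate : ND L (coordinate zero β sβ)
  near-coordinate = ImageWithin⇒near sβ im (λ y → scale-InSpan β _)
  near-𝟘 : ND L D-𝟘
  near-𝟘 = ImageWithin⇒near sβ im (λ _ → inj₁ refl)

¬ImageInUnitSpan⇒Isolated : (L : D m n) → (∀ β → ¬ ImageInUnitSpan β (fun L)) → Isolated L
¬ImageInUnitSpan⇒Isolated {n = n} L none = near-refl L , agree
  where
  agree : ∀ K → ND L K → ∀ x → fun K x ≡ fun L x
  agree K near x with fun L x ⊕ fun K x ≟ᴮ 𝟘 n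
  ... | yes p  = sym (⊕≡𝟘⇒≡ _ _ p)
  ... | no γ≢𝟘 = ⊥-elim (none _ (proj₁ (near⇒ImageInUnitSpan L K near x γ≢𝟘)))

near-ImageWithin : (L K : D m n) (y : B m) → ND L K → fun L y ≢ 𝟘 n →
  ImageWithin (fun L y) (fun L) → ImageWithin (fun L y) (fun K)
near-ImageWithin {n = n} L K y near Ly≢𝟘 im x with fun L x ⊕ fun K x ≟ᴮ 𝟘 n
... | yes p  = subst (InSpan (fun L y)) (⊕≡𝟘⇒≡ _ _ p) (im x)
... | no γ≢𝟘 =
  let ((_ , _ , imL) , imK) = near⇒ImageInUnitSpan L K near x γ≢𝟘
  in subst (λ w → InSpan w (fun K x)) (sym (InSpan-≢𝟘 (imL y) Ly≢𝟘)) (imK x)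

classify : (L : D m n) →
  (∀ β → ¬ ImageInUnitSpan β (fun L)) ⊎ Constant L ⊎ ∃ λ y → ImageInUnitSpan (fun L y) (fun L)
classify {n = n} L with all⊎counterexample (λ y → fun L y ≡ 𝟘 n) (λ y → fun L y ≟ᴮ 𝟘 n)
... | inj₁ constant = inj₂ (inj₁ constant)
... | inj₂ (y , Ly≢𝟘)
  with Small? (fun L y) | all⊎counterexample (λ z → InSpan (fun L y) (fun L z)) (λ z → InSpan? (fun L y) (fun L z))
... | yes s | inj₁ im        = inj₂ (inj₂ (y , s , Ly≢𝟘 , im))
... | no ¬s | _              = inj₁ λ { β (sβ , _ , im) → ¬s (subst Small (sym (InSpan-≢𝟘 (im y) Ly≢𝟘)) sβ) }
... | yes _ | inj₂ (z , ¬in) = inj₁ λ { β (_ , _ , im) →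
  ¬in (subst (λ w → InSpan w (fun L z)) (sym (InSpan-≢𝟘 (im y) Ly≢𝟘)) (im z)) }

principal : {X : Set} (P : Pred X 0ℓ) {x : X} → P x → Filter X
principal P Px = record
  { member = P ⊆_
  ; univ   = λ _ → tt
  ; proper = λ P⊆∅ → P⊆∅ Px
  ; upward = λ Q⊆R P⊆Q p → Q⊆R (P⊆Q p)
  ; meet   = λ P⊆Q P⊆R p → P⊆Q p , P⊆R p
  }

Covered : D m n → (B m → B n) → B m → Set
Covered L f b = ∀ x → N b x → ∃ λ K → ND L K × f x ≡ fun K x

-- Both directions are witnessed by principal filters: N(b) for 𝒜 and N(L) ∩ 𝒟 for ℒ.
differential⇔covered : (L : D m n) (f : B m → B n) (b : B m) → IsDifferential L f b ⇔ Covered L f b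
differential⇔covered L f b = mk⇔ covered differential
  where
  covered : IsDifferential L f b → Covered L f b
  covered d x b∼x =
    let (ℒ , ℒ→L , witness) = d (principal (N b) (inj₁ refl)) (λ p → p)
        (A , N[b]⊆A , onA)  = witness (ND L) ℒ→L
    in onA x (N[b]⊆A b∼x)

  differential : Covered L f b → IsDifferential L f b
  differential cov 𝒜 𝒜→b = principal (ND L) {L} (near-refl L) , (λ p → p) ,
    λ K N[L]⊆K → N b , 𝒜→b , λ x b∼x →
      let (k , near , fx≡kx) = cov x b∼x in k , N[L]⊆K near , fx≡kx

covered⇒f𝟘≡𝟘 : (L : D m n) (f : B m → B n) (b : B m) → Covered L f b → N b (𝟘 m) → f (𝟘 m) ≡ 𝟘 n
covered⇒f𝟘≡𝟘 L f b cov b∼𝟘 = let (k , _ , f𝟘≡k𝟘) = cov _ b∼𝟘 in trans f𝟘≡k𝟘 (linear-𝟘 k)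

near-map-attaining : {β : B n} (L : D m n) → ImageInUnitSpan β (fun L) →
  ∀ x {v} → InSpan β v → (x ≡ 𝟘 m → v ≡ 𝟘 n) → ∃ λ K → ND L K × v ≡ fun K x
near-map-attaining L (sβ , _ , im) x (inj₁ v≡𝟘) _ =
  D-𝟘 , ImageWithin⇒near sβ im (λ _ → inj₁ refl) , v≡𝟘
near-map-attaining {β = β} L (sβ , β≢𝟘 , im) x (inj₂ v≡β) x≡𝟘⇒v≡𝟘 with zero⊎lookup≡true x
... | inj₁ x≡𝟘       = ⊥-elim (β≢𝟘 (trans (sym v≡β) (x≡𝟘⇒v≡𝟘 x≡𝟘)))
... | inj₂ (j , xⱼ) = coordinate j β sβ , ImageWithin⇒near sβ im (λ y → scale-InSpan β _) ,
                       trans v≡β (cong (scale β) (sym xⱼ))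

Small⇒InSpan-e : {v : B (suc n)} → Small v → ∃ λ i → InSpan (e i) v
Small⇒InSpan-e (inj₁ v≡𝟘)       = zero , inj₁ v≡𝟘
Small⇒InSpan-e (inj₂ (i , v≡e)) = i , inj₂ v≡e

Criterion : D m n → (B m → B n) → B m → Set
Criterion {m} {n} L f b =
      ( (Isolated L × (∀ x → N b x → fun L x ≡ f x))
      ⊎ ((¬ Isolated L × Constant L × (∀ x → N b x → N (𝟘 n) (f x))
            × (N b (𝟘 m) → f (𝟘 m) ≡ 𝟘 n))
      ⊎ (¬ Isolated L × ¬ Constant L
            × ∃! _≡_ (λ β → (N (𝟘 n) β × β ≢ 𝟘 n)
                 × (∀ x → N b x → ∃[ z ] (fun L z ≡ f x))
                 × (∀ y → (∃[ z ] (fun L z ≡ y)) ⇔ ((y ≡ 𝟘 n) ⊎ (y ≡ β))))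
            × (N b (𝟘 m) → f (𝟘 m) ≡ 𝟘 n))) )

image⇔span : {β : B n} (L : D m n) (y : B m) → fun L y ≡ β → ImageWithin β (fun L) →
  ∀ v → (∃[ z ] (fun L z ≡ v)) ⇔ ((v ≡ 𝟘 n) ⊎ (v ≡ β))
image⇔span L y Ly≡β im v = mk⇔
  (λ { (z , Lz≡v) → subst (InSpan _) Lz≡v (im z) })
  (λ { (inj₁ v≡𝟘) → _ , trans (linear-𝟘 L) (sym v≡𝟘) ; (inj₂ v≡β) → y , trans Ly≡β (sym v≡β) })

covered⇒criterion : (L : D (suc m) (suc n)) (f : B (suc m) → B (suc n)) (b : B (suc m)) →
  Covered L f b → Criterion L f b
covered⇒criterion {n = n} L f b cov with classify L
... | inj₁ none = inj₁ (isolated , λ x b∼x →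
        let (k , near , fx≡kx) = cov x b∼x in sym (trans fx≡kx (proj₂ isolated k near x)))
  where
  isolated : Isolated L
  isolated = ¬ImageInUnitSpan⇒Isolated L none
... | inj₂ (inj₁ constant) = inj₂ (inj₁ (¬isolated , constant , f-small , covered⇒f𝟘≡𝟘 L f b cov))
  where
  ¬isolated : ¬ Isolated L
  ¬isolated = ImageInUnitSpan⇒¬Isolated L (inj₂ (zero , refl) , e≢𝟘 zero , λ y → inj₁ (constant y))
  f-small : ∀ x → N b x → Small (f x)
  f-small x b∼x = let (k , near , fx≡kx) = cov x b∼x in
    subst₂ N (constant x) (sym fx≡kx) (near x x (inj₁ refl))
... | inj₂ (inj₂ (y , unitSpan@(sβ , β≢𝟘 , im))) =
  inj₂ (inj₂ (ImageInUnitSpan⇒¬Isolated L unitSpan , (λ c → β≢𝟘 (c y)) ,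
              (fun L y , ((sβ , β≢𝟘) , f-in-image , image⇔span L y refl im) , unique) ,
              covered⇒f𝟘≡𝟘 L f b cov))
  where
  f-in-image : ∀ x → N b x → ∃[ z ] (fun L z ≡ f x)
  f-in-image x b∼x = let (k , near , fx≡kx) = cov x b∼x in
    Equivalence.from (image⇔span L y refl im (f x))
      (subst (InSpan (fun L y)) (sym fx≡kx) (near-ImageWithin L k y near β≢𝟘 im x))
  unique : ∀ {β′} → (N (𝟘 (suc n)) β′ × β′ ≢ 𝟘 (suc n)) × (∀ x → N b x → ∃[ z ] (fun L z ≡ f x))
           × (∀ v → (∃[ z ] (fun L z ≡ v)) ⇔ ((v ≡ 𝟘 (suc n)) ⊎ (v ≡ β′))) → fun L y ≡ β′
  unique ((_ , β′≢𝟘) , _ , image⇔β′) =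
    let (z , Lz≡β′) = Equivalence.from (image⇔β′ _) (inj₂ refl)
    in trans (sym (InSpan-≢𝟘 (im z) (λ Lz≡𝟘 → β′≢𝟘 (trans (sym Lz≡β′) Lz≡𝟘)))) Lz≡β′

criterion⇒covered : (L : D m (suc n)) (f : B m → B (suc n)) (b : B m) → Criterion L f b → Covered L f b
criterion⇒covered L f b (inj₁ (_ , agree)) x b∼x = L , near-refl L , sym (agree x b∼x)
criterion⇒covered L f b (inj₂ (inj₁ (_ , constant , f-small , f𝟘≡𝟘))) x b∼x =
  let (i , fx∈span) = Small⇒InSpan-e (f-small x b∼x)
  in near-map-attaining L (inj₂ (i , refl) , e≢𝟘 i , λ y → inj₁ (constant y)) x fx∈span
       λ { refl → f𝟘≡𝟘 b∼x }
criterion⇒covered L f b (inj₂ (inj₂ (_ , _ , (β , ((sβ , β≢𝟘) , f-in-image , image⇔β) , _) , f𝟘≡𝟘))) x b∼x =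
  near-map-attaining L (sβ , β≢𝟘 , λ y → Equivalence.to (image⇔β _) (y , refl)) x
    (Equivalence.to (image⇔β (f x)) (f-in-image x b∼x)) λ { refl → f𝟘≡𝟘 b∼x }

theorem5p4 : (m n : ℕ) → 1 ≤ m → 1 ≤ n →
    (L : D m n) (f : B m → B n) (b : B m) →
    IsDifferential L f b ⇔
      ( (Isolated L × (∀ x → N b x → fun L x ≡ f x))
      ⊎ ((¬ Isolated L × Constant L × (∀ x → N b x → N (𝟘 n) (f x))
            × (N b (𝟘 m) → f (𝟘 m) ≡ 𝟘 n))
      ⊎ (¬ Isolated L × ¬ Constant L
            × ∃! _≡_ (λ β → (N (𝟘 n) β × β ≢ 𝟘 n)
                 × (∀ x → N b x → ∃[ z ] (fun L z ≡ f x))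
                 × (∀ y → (∃[ z ] (fun L z ≡ y)) ⇔ ((y ≡ 𝟘 n) ⊎ (y ≡ β))))
            × (N b (𝟘 m) → f (𝟘 m) ≡ 𝟘 n))) )
theorem5p4 (suc m) (suc n) _ _ L f b =
  mk⇔ (covered⇒criterion L f b) (criterion⇒covered L f b) ⇔-∘ differential⇔covered L f b
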